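{- Let $n\ge1$. If every $\boldsymbol{\Delta}^1_n$ set of reals has the dual Ramsey property, then every $\boldsymbol{\Delta}^1_n$ set of reals has the Ramsey property.
   Context: Reals are subsets of $\omega$. A set $A\subseteq[\omega]^\omega$ has the Ramsey property iff there is an infinite $x\subseteq\omega$ with $[x]^\omega\subseteq A$ or $[x]^\omega\cap A=\emptyset$. $(\omega)^\omega$ is the set of partitions of $\omega$ into infinitely many blocks; for $X,Y\in(\omega)^\omega$, $Y\preccurlyeq X$ means every block of $Y$ is a union of blocks of $X$, and $(X):=\{Y\in(\omega)^\omega:Y\preccurlyeq X\}$. $A\subseteq(\omega)^\omega$ has the dual Ramsey property iff some $X\in(\omega)^\omega$ has $(X)\subseteq A$ or $(X)\cap A=\emptyset$. Fix an arithmetic bijection $\flat$ from pairs of natural numbers onto $\omega$, let $\mathrm{pc}(X):=\{\flat(n,m):n,m$ in the same block of $X\}$; a set of reals $A$ has the dual Ramsey property iff $\{X\in(\omega)^\omega:\mathrm{pc}(X)\in A\}$ does. -}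

module Defs where

open import Data.Nat using (ℕ; zero; suc; _≤_)
open import Data.Bool using (Bool; true; false)
open import Data.Fin using (Fin)
open import Data.Vec using (Vec; []; _∷_)
open import Data.Product using (Σ; _×_; _,_; proj₁; proj₂; ∃)
open import Data.Sum using (_⊎_)
open import Relation.Nullary using (¬_)
open import Relation.Binary.PropositionalEquality using (_≡_; _≢_)
open import Function.Bundles using (_⇔_)

-- A real is (the characteristic function of) a subset of ω.
Real : Set
Real = ℕ → Bool

-- Elements of Baire space ω^ω (auxiliary coordinates for projections).
Baire : Set
Baire = ℕ → ℕ

SetOfReals : Set₁
SetOfReals = Real → Set

Pred : ℕ → Set₁
Pred k = Real → (Fin k → Baire) → Set

take : {A : Set} → (m : ℕ) → (ℕ → A) → Vec A m
take zero    f = []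
take (suc m) f = f 0 ∷ take m (λ i → f (suc i))

-- Closed subsets of 2^ω × (ω^ω)^k: sets of points all of whose finite
-- approximations satisfy a given (arbitrary) relation R.
IsClosed : (k : ℕ) → Pred k → Set₁
IsClosed k A = Σ ((m : ℕ) → Vec Bool m → (Fin k → Vec ℕ m) → Set) λ R →
  ∀ x ys → A x ys ⇔ (∀ m → R m (take m x) (λ i → take m (ys i)))

IsOpen : (k : ℕ) → Pred k → Set₁
IsOpen k A = Σ ((m : ℕ) → Vec Bool m → (Fin k → Vec ℕ m) → Set) λ R →
  ∀ x ys → A x ys ⇔ (∃ λ m → R m (take m x) (λ i → take m (ys i)))

cons : {k : ℕ} → Baire → (Fin k → Baire) → Fin (suc k) → Baire
cons y ys Fin.zero    = y
cons y ys (Fin.suc i) = ys i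

-- Boldface projective pointclasses on 2^ω × (ω^ω)^k.
-- Σ¹ 0 = open, Π¹ 0 = closed, Σ¹ (n+1) = projections of Π¹ n sets,
-- Π¹ (n+1) = complements of Σ¹ (n+1) sets.
mutual
  Σ¹ : ℕ → (k : ℕ) → Pred k → Set₁
  Σ¹ zero    k A = IsOpen k A
  Σ¹ (suc n) k A = Σ (Pred (suc k)) λ B → Π¹ n (suc k) B ×
    (∀ x ys → A x ys ⇔ (∃ λ y → B x (cons y ys)))

  Π¹ : ℕ → (k : ℕ) → Pred k → Set₁
  Π¹ zero    k A = IsClosed k A
  Π¹ (suc n) k A = Σ (Pred k) λ B → Σ¹ (suc n) k B ×
    (∀ x ys → A x ys ⇔ (¬ B x ys))

asPred : SetOfReals → Pred 0
asPred A x _ = A x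

Δ¹ : ℕ → SetOfReals → Set₁
Δ¹ n A = Σ¹ n 0 (asPred A) × Π¹ n 0 (asPred A)

Infinite : Real → Set
Infinite x = ∀ n → ∃ λ m → n ≤ m × x m ≡ true

_⊆ʳ_ : Real → Real → Set
y ⊆ʳ x = ∀ m → y m ≡ true → x m ≡ true

RamseyProperty : SetOfReals → Set
RamseyProperty A = Σ Real λ x → Infinite x ×
  ((∀ y → Infinite y → y ⊆ʳ x → A y) ⊎ (∀ y → Infinite y → y ⊆ʳ x → ¬ A y))

-- A partition of ω into infinitely many blocks, given by its
-- "same block" relation (an equivalence relation with infinitely many classes).
record Partition : Set where
  field
    same   : ℕ → ℕ → Bool
    refl′  : ∀ a → same a a ≡ true
    sym′   : ∀ a b → same a b ≡ true → same b a ≡ true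
    trans′ : ∀ a b c → same a b ≡ true → same b c ≡ true → same a c ≡ true
    infiniteBlocks : ∀ n → Σ (Fin n → ℕ) λ f →
      ∀ i j → i ≢ j → same (f i) (f j) ≡ false
open Partition public

-- Y ≼ X : every block of Y is a union of blocks of X
-- (equivalently, elements in the same X-block are in the same Y-block).
_≼_ : Partition → Partition → Set
Y ≼ X = ∀ a b → same X a b ≡ true → same Y a b ≡ true

-- Cantor enumeration of ℕ × ℕ along diagonals; its inverse is the
-- (arithmetic) Cantor pairing bijection ♭.
unpair : ℕ → ℕ × ℕ
unpair zero    = 0 , 0
unpair (suc k) with unpair k
... | zero   , m = suc m , 0
... | suc n  , m = n , suc m

pc : Partition → Real
pc X k = same X (proj₁ (unpair k)) (proj₂ (unpair k))

DualRamseyProperty : SetOfReals → Set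
DualRamseyProperty A = Σ Partition λ X →
  ((∀ Y → Y ≼ X → A (pc Y)) ⊎ (∀ Y → Y ≼ X → ¬ A (pc Y)))

{-# OPTIONS --safe #-}
module Submission where

-- Let minima z be the real containing ♭(b,b) exactly when b > 0 and no ♭(a,b) with a < b
-- lies in z; for a partition X, minima (pc X) codes the positive minima of the blocks of X.
-- Bit ♭(b,b) of minima z depends only on smaller bits of z, so minima is continuous and
-- Δ¹ₙ sets pull back to Δ¹ₙ sets. Moreover every infinite subset of minima (pc X) is
-- minima (pc Y) for some Y ≼ X: keep the chosen minima, and merge every other block of X
-- into the block of the largest chosen minimum below its own minimum (or into the block of 0).
-- So if (X) is homogeneous for the preimage of A, then minima (pc X) is homogeneous for A.

open import Defs
open import Data.Bool using (Bool; true; false; if_then_else_)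
import Data.Bool.Properties as Bool
open import Data.Fin using (Fin; toℕ; fromℕ<)
import Data.Fin.Properties as Fin
open import Data.Nat using (ℕ; zero; suc; _+_; _≤_; _<_; _≟_; _<?_; z≤n; s≤s)
open import Data.Nat.Properties
open import Data.Nat.Induction using (<-rec)
open import Data.Product using (∃; _×_; _,_; proj₁; proj₂)
open import Data.Sum using (_⊎_; inj₁; inj₂)
import Data.Sum as Sum
open import Data.Vec using (Vec; []; _∷_)
open import Function using (_∘_)
open import Function.Bundles using (_⇔_; mk⇔; Equivalence)
open import Relation.Binary.Definitions using (tri<; tri≈; tri>; _Respects_)
open import Relation.Binary.PropositionalEquality
open import Relation.Nullary using (¬_; Dec; yes; no; does; contradiction)
open import Relation.Nullary.Decidable using (dec-true; dec-false; does-⇔; _×-dec_)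

open Equivalence

tri : ℕ → ℕ
tri zero    = 0
tri (suc s) = suc (s + tri s)

pair : ℕ → ℕ → ℕ
pair a b = b + tri (b + a)

unpair-step : ∀ {k a c} → unpair k ≡ (suc a , c) → unpair (suc k) ≡ (a , suc c)
unpair-step e rewrite e = refl

unpair-restart : ∀ {k c} → unpair k ≡ (0 , c) → unpair (suc k) ≡ (suc c , 0)
unpair-restart e rewrite e = refl

unpair-walk : ∀ {k a c} b → unpair k ≡ (b + a , c) → unpair (b + k) ≡ (a , b + c)
unpair-walk zero e = e
unpair-walk {k} {a} {c} (suc b) e =
  unpair-step {b + k} (unpair-walk {k} b (trans e (cong (_, c) (sym (+-suc b a)))))

unpair-tri : ∀ s → unpair (tri s) ≡ (s , 0)
unpair-tri zero    = refl
unpair-tri (suc s) = unpair-restart {s + tri s} (trans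
  (unpair-walk {tri s} s (trans (unpair-tri s) (cong (_, 0) (sym (+-identityʳ s)))))
  (cong (0 ,_) (+-identityʳ s)))

unpair-pair : ∀ a b → unpair (pair a b) ≡ (a , b)
unpair-pair a b =
  trans (unpair-walk {tri (b + a)} b (unpair-tri (b + a))) (cong (a ,_) (+-identityʳ b))

pair-unpair : ∀ k → pair (proj₁ (unpair k)) (proj₂ (unpair k)) ≡ k
pair-unpair zero = refl
pair-unpair (suc k) with unpair k | pair-unpair k
... | suc a , b | e = cong suc (trans (cong (λ s → b + tri s) (sym (+-suc b a))) e)
... | zero  , b | e = cong suc (trans (cong (λ s → b + tri s) (sym (+-identityʳ b))) e)

tri-mono-≤ : ∀ {s t} → s ≤ t → tri s ≤ tri t
tri-mono-≤ z≤n       = z≤n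
tri-mono-≤ (s≤s s≤t) = s≤s (+-mono-≤ s≤t (tri-mono-≤ s≤t))

tri-mono-< : ∀ {s t} → s < t → tri s < tri t
tri-mono-< {s} s<t = <-≤-trans (s≤s (m≤n+m (tri s) s)) (tri-mono-≤ s<t)

pair-<-diagonal : ∀ {a b} → a < b → pair a b < pair b b
pair-<-diagonal {b = b} a<b = +-monoʳ-< b (tri-mono-< (+-monoʳ-< b a<b))

pair-diagonal-< : ∀ {a b} → a < b → pair a a < pair b b
pair-diagonal-< a<b = +-mono-< a<b (tri-mono-< (+-mono-< a<b a<b))

pair-diagonal-≤⁻¹ : ∀ {a b} → pair a a ≤ pair b b → a ≤ b
pair-diagonal-≤⁻¹ le = ≮⇒≥ (λ b<a → <⇒≱ (pair-diagonal-< b<a) le)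

≤-pair-diagonal : ∀ b → b ≤ pair b b
≤-pair-diagonal b = m≤m+n b _

pc-pair : ∀ X a b → pc X (pair a b) ≡ same X a b
pc-pair X a b = cong (λ p → same X (proj₁ p) (proj₂ p)) (unpair-pair a b)

IsBlockMin : (ℕ → ℕ → Bool) → ℕ → Set
IsBlockMin r b = ∀ {a} → a < b → r a b ≡ false

blockMin-unique : ∀ {r : ℕ → ℕ → Bool} → (∀ {a b} → r a b ≡ true → r b a ≡ true) →
                  ∀ {m m′} → IsBlockMin r m → IsBlockMin r m′ → r m m′ ≡ true → m ≡ m′
blockMin-unique r-sym {m} {m′} min min′ m~m′ with <-cmp m m′
... | tri< m<m′ _ _ = contradiction (trans (sym m~m′) (min′ m<m′)) λ ()
... | tri≈ _ m≡m′ _ = m≡m′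
... | tri> _ _ m′<m = contradiction (trans (sym (r-sym m~m′)) (min m′<m)) λ ()

module _ (X : Partition) where

  BlockMinimumOf : ℕ → Set
  BlockMinimumOf a = ∃ λ m → m ≤ a × same X m a ≡ true × IsBlockMin (same X) m

  blockMinimum : ∀ a → BlockMinimumOf a
  blockMinimum = <-rec BlockMinimumOf descend
    where
    descend : ∀ a → (∀ {c} → c < a → BlockMinimumOf c) → BlockMinimumOf a
    descend a below with anyUpTo? (λ c → same X c a Bool.≟ true) a
    ... | yes (c , c<a , c~a) =
      let m , m≤c , m~c , min = below c<a
      in m , ≤-trans m≤c (<⇒≤ c<a) , trans′ X m c a m~c c~a , min
    ... | no none = a , ≤-refl , refl′ X a , λ c<a → Bool.¬-not (λ c~a → none (_ , c<a , c~a))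

  blockMin : ℕ → ℕ
  blockMin a = proj₁ (blockMinimum a)

  blockMin-≤ : ∀ a → blockMin a ≤ a
  blockMin-≤ a = proj₁ (proj₂ (blockMinimum a))

  blockMin-same : ∀ a → same X (blockMin a) a ≡ true
  blockMin-same a = proj₁ (proj₂ (proj₂ (blockMinimum a)))

  blockMin-isBlockMin : ∀ a → IsBlockMin (same X) (blockMin a)
  blockMin-isBlockMin a = proj₂ (proj₂ (proj₂ (blockMinimum a)))

  blockMin-≡⇒same : ∀ {a b} → blockMin a ≡ blockMin b → same X a b ≡ true
  blockMin-≡⇒same {a} {b} e = trans′ X a (blockMin b) b
    (subst (λ m → same X a m ≡ true) e (sym′ X _ a (blockMin-same a))) (blockMin-same b)

  same⇒blockMin-≡ : ∀ {a b} → same X a b ≡ true → blockMin a ≡ blockMin b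
  same⇒blockMin-≡ {a} {b} a~b =
    blockMin-unique (sym′ X _ _) (blockMin-isBlockMin a) (blockMin-isBlockMin b)
      (trans′ X _ a _ (blockMin-same a) (trans′ X a b _ a~b (sym′ X _ b (blockMin-same b))))

  blockMin-fixed : ∀ {b} → IsBlockMin (same X) b → blockMin b ≡ b
  blockMin-fixed {b} min =
    blockMin-unique (sym′ X _ _) (blockMin-isBlockMin b) min (blockMin-same b)

  blockMin-unbounded : ∀ n → ∃ λ b → n < b × IsBlockMin (same X) b
  blockMin-unbounded n with infiniteBlocks X (suc (suc n))
  ... | f , apart with Fin.any? (λ i → n <? blockMin (f i))
  ...   | yes (i , n<b) = blockMin (f i) , n<b , blockMin-isBlockMin (f i)
  ...   | no none
    with Fin.pigeonhole (n<1+n (suc n)) (λ i → fromℕ< (s≤s (≮⇒≥ (λ n<b → none (i , n<b)))))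
  ...     | i , j , i<j , e = contradiction
    (blockMin-≡⇒same (Fin.fromℕ<-injective _ _ _ _ e))
    (λ fi~fj → Bool.not-¬ fi~fj (apart i j (Fin.<⇒≢ i<j)))

does⇒ : ∀ {A : Set} (a? : Dec A) → does a? ≡ true → A
does⇒ (yes a) _ = a

Unbounded : (ℕ → Set) → Set
Unbounded P = ∀ n → ∃ λ m → n ≤ m × P m

module Enumeration {P : ℕ → Set} (unbounded : Unbounded P) where

  enumerate : ℕ → ℕ
  enumerate zero    = proj₁ (unbounded 0)
  enumerate (suc k) = proj₁ (unbounded (suc (enumerate k)))

  enumerate-P : ∀ k → P (enumerate k)
  enumerate-P zero    = proj₂ (proj₂ (unbounded 0))
  enumerate-P (suc k) = proj₂ (proj₂ (unbounded (suc (enumerate k))))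

  enumerate-step : ∀ k → enumerate k < enumerate (suc k)
  enumerate-step k = proj₁ (proj₂ (unbounded (suc (enumerate k))))

  enumerate-< : ∀ {i j} → i < j → enumerate i < enumerate j
  enumerate-< {i} {suc j} (s≤s i≤j) with m≤n⇒m<n∨m≡n i≤j
  ... | inj₁ i<j  = <-trans (enumerate-< i<j) (enumerate-step j)
  ... | inj₂ refl = enumerate-step i

  enumerate-injective : ∀ {i j} → enumerate i ≡ enumerate j → i ≡ j
  enumerate-injective {i} {j} e with <-cmp i j
  ... | tri< i<j _ _ = contradiction e (<⇒≢ (enumerate-< i<j))
  ... | tri≈ _ i≡j _ = i≡j
  ... | tri> _ _ j<i = contradiction (sym e) (<⇒≢ (enumerate-< j<i))

fibres : (f : ℕ → ℕ) → Unbounded (λ c → f c ≡ c) → Partition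
fibres f fixed = record
  { same           = λ a b → does (f a ≟ f b)
  ; refl′          = λ a → dec-true (f a ≟ f a) refl
  ; sym′           = λ a b e → dec-true (f b ≟ f a) (sym (does⇒ (f a ≟ f b) e))
  ; trans′         = λ a b c e e′ →
      dec-true (f a ≟ f c) (trans (does⇒ (f a ≟ f b) e) (does⇒ (f b ≟ f c) e′))
  ; infiniteBlocks = λ n → enumerate ∘ toℕ , λ i j i≢j → dec-false (f _ ≟ f _) (values-apart i≢j)
  }
  where
  open Enumeration fixed
  values-apart : ∀ {n} {i j : Fin n} → i ≢ j → f (enumerate (toℕ i)) ≢ f (enumerate (toℕ j))
  values-apart {i = i} {j} i≢j e = i≢j (Fin.toℕ-injective (enumerate-injective
    (trans (sym (enumerate-P (toℕ i))) (trans e (enumerate-P (toℕ j))))))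

decode : Real → ℕ → ℕ → Bool
decode z a b = z (pair a b)

Selected : Real → ℕ → ℕ → Set
Selected z a b = a ≡ b × 0 < b × IsBlockMin (decode z) b

selected? : ∀ z a b → Dec (Selected z a b)
selected? z a b = a ≟ b ×-dec 0 <? b ×-dec allUpTo? (λ c → z (pair c b) Bool.≟ false) b

minima : Real → Real
minima z j = does (selected? z (proj₁ (unpair j)) (proj₂ (unpair j)))

minima-diagonal : ∀ z b → minima z (pair b b) ≡ true ⇔ (0 < b × IsBlockMin (decode z) b)
minima-diagonal z b = mk⇔
  (λ e → proj₂ (does⇒ (selected? z b b) (trans (sym at-b) e)))
  (λ s → trans at-b (dec-true (selected? z b b) (refl , s)))
  where
  at-b : minima z (pair b b) ≡ does (selected? z b b)
  at-b = cong (λ p → does (selected? z (proj₁ p) (proj₂ p))) (unpair-pair b b)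

minima-support : ∀ z j → minima z j ≡ true → ∃ λ b → j ≡ pair b b
minima-support z j e = b , trans (sym (pair-unpair j)) (cong (λ a → pair a b) a≡b)
  where
  b = proj₂ (unpair j)
  a≡b = proj₁ (does⇒ (selected? z _ _) e)

minima-pc : ∀ X b → minima (pc X) (pair b b) ≡ true ⇔ (0 < b × IsBlockMin (same X) b)
minima-pc X b = mk⇔
  (λ e → let b>0 , min = to (minima-diagonal (pc X) b) e
         in b>0 , λ {c} c<b → trans (sym (pc-pair X c b)) (min c<b))
  (λ (b>0 , min) →
     from (minima-diagonal (pc X) b) (b>0 , λ {c} c<b → trans (pc-pair X c b) (min c<b)))

minima-infinite : ∀ X → Infinite (minima (pc X))
minima-infinite X n with blockMin-unbounded X n
... | b , n<b , min = pair b b , ≤-trans (<⇒≤ n<b) (≤-pair-diagonal b) ,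
                      from (minima-pc X b) (≤-<-trans z≤n n<b , min)

AgreeBelow : {A : Set} → ℕ → (ℕ → A) → (ℕ → A) → Set
AgreeBelow M f g = ∀ {i} → i < M → f i ≡ g i

NonExpansive : (Real → Real) → Set
NonExpansive h = ∀ {M x x′} → AgreeBelow M x x′ → AgreeBelow M (h x) (h x′)

minima-local : ∀ {x x′} j → AgreeBelow (suc j) x x′ → minima x j ≡ minima x′ j
minima-local {x} {x′} j agree =
  does-⇔ (mk⇔ (transfer agree) (transfer (sym ∘ agree))) (selected? x a b) (selected? x′ a b)
  where
  a = proj₁ (unpair j)
  b = proj₂ (unpair j)
  below-j : ∀ {c} → a ≡ b → c < b → pair c b < suc j
  below-j {c} a≡b c<b = s≤s (<⇒≤ (begin-strict
    pair c b <⟨ pair-<-diagonal c<b ⟩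
    pair b b ≡⟨ cong (λ a → pair a b) (sym a≡b) ⟩
    pair a b ≡⟨ pair-unpair j ⟩
    j        ∎))
    where open ≤-Reasoning
  transfer : ∀ {y y′} → AgreeBelow (suc j) y y′ → Selected y a b → Selected y′ a b
  transfer agree (a≡b , b>0 , min) =
    a≡b , b>0 , λ {c} c<b → trans (sym (agree (below-j a≡b c<b))) (min c<b)

minima-nonExpansive : NonExpansive minima
minima-nonExpansive agree {j} j<M = minima-local j (λ i≤j → agree (<-≤-trans i≤j j<M))

take-cong : ∀ {A : Set} M {f g : ℕ → A} → AgreeBelow M f g → take M f ≡ take M g
take-cong zero    agree = refl
take-cong (suc M) agree = cong₂ _∷_ (agree (s≤s z≤n)) (take-cong M (λ i<M → agree (s≤s i<M)))

pad : ∀ {M} → Vec Bool M → Real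
pad []      _       = false
pad (b ∷ v) zero    = b
pad (b ∷ v) (suc i) = pad v i

pad-take : ∀ M x → AgreeBelow M (pad (take M x)) x
pad-take (suc M) x {zero}  _         = refl
pad-take (suc M) x {suc i} (s≤s i<M) = pad-take M (λ i → x (suc i)) i<M

ApproxRel : ℕ → Set₁
ApproxRel k = (m : ℕ) → Vec Bool m → (Fin k → Vec ℕ m) → Set

subst-approx : ∀ {k} (R : ApproxRel k) {m u v ts} → u ≡ v → R m u ts → R m v ts
subst-approx R refl r = r

preimage : (Real → Real) → ∀ {k} → Pred k → Pred k
preimage h A x ys = A (h x) ys

module _ {h : Real → Real} (h-nonExpansive : NonExpansive h) where

  take-h-pad : ∀ M x → take M (h (pad (take M x))) ≡ take M (h x)
  take-h-pad M x = take-cong M (h-nonExpansive (pad-take M x))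

  pullback : ∀ {k} → ApproxRel k → ApproxRel k
  pullback R M s = R M (take M (h (pad s)))

  mutual
    preimage-Σ¹ : ∀ n {k A} → Σ¹ n k A → Σ¹ n k (preimage h A)
    preimage-Σ¹ zero (R , A⇔) = pullback R , λ x ys → mk⇔
      (λ a → let m , r = to (A⇔ (h x) ys) a
             in m , subst-approx R (sym (take-h-pad m x)) r)
      (λ (m , r) → from (A⇔ (h x) ys) (m , subst-approx R (take-h-pad m x) r))
    preimage-Σ¹ (suc n) (B , B∈Π¹ , A⇔) = preimage h B , preimage-Π¹ n B∈Π¹ , λ x → A⇔ (h x)

    preimage-Π¹ : ∀ n {k A} → Π¹ n k A → Π¹ n k (preimage h A)
    preimage-Π¹ zero (R , A⇔) = pullback R , λ x ys → mk⇔
      (λ a m → subst-approx R (sym (take-h-pad m x)) (to (A⇔ (h x) ys) a m))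
      (λ r → from (A⇔ (h x) ys) (λ m → subst-approx R (take-h-pad m x) (r m)))
    preimage-Π¹ (suc n) (B , B∈Σ¹ , A⇔) =
      preimage h B , preimage-Σ¹ (suc n) B∈Σ¹ , λ x → A⇔ (h x)

-- Reals are compared pointwise (there is no function extensionality), so invariance
-- under ≗ has to be proved.
mutual
  Σ¹-respects-≗ : ∀ n {k A} → Σ¹ n k A → ∀ ys → (λ x → A x ys) Respects _≗_
  Σ¹-respects-≗ zero (R , A⇔) ys {x} {x′} x≗x′ a =
    let m , r = to (A⇔ x ys) a
    in from (A⇔ x′ ys) (m , subst-approx R (take-cong m (λ {i} _ → x≗x′ i)) r)
  Σ¹-respects-≗ (suc n) (B , B∈Π¹ , A⇔) ys {x} {x′} x≗x′ a =
    let y , b = to (A⇔ x ys) a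
    in from (A⇔ x′ ys) (y , Π¹-respects-≗ n B∈Π¹ _ x≗x′ b)

  Π¹-respects-≗ : ∀ n {k A} → Π¹ n k A → ∀ ys → (λ x → A x ys) Respects _≗_
  Π¹-respects-≗ zero (R , A⇔) ys {x} {x′} x≗x′ a =
    from (A⇔ x′ ys) (λ m → subst-approx R (take-cong m (λ {i} _ → x≗x′ i)) (to (A⇔ x ys) a m))
  Π¹-respects-≗ (suc n) (B , B∈Σ¹ , A⇔) ys {x} {x′} x≗x′ a =
    from (A⇔ x′ ys) (λ b′ → to (A⇔ x ys) a (Σ¹-respects-≗ (suc n) B∈Σ¹ ys (sym ∘ x≗x′) b′))

module Coarsening (X : Partition) (y : Real) (y-infinite : Infinite y)
                  (y⊆minima : y ⊆ʳ minima (pc X)) where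

  chosen : Real
  chosen b = y (pair b b)

  chosen-isBlockMin : ∀ {b} → chosen b ≡ true → 0 < b × IsBlockMin (same X) b
  chosen-isBlockMin e = to (minima-pc X _) (y⊆minima _ e)

  chosen-infinite : Infinite chosen
  chosen-infinite n with y-infinite (pair n n)
  ... | m , nn≤m , ym with minima-support (pc X) m (y⊆minima m ym)
  ...   | b , refl = b , pair-diagonal-≤⁻¹ nn≤m , ym

  Anchor : ℕ → Set
  Anchor c = c ≡ 0 ⊎ chosen c ≡ true

  lastAnchor : ℕ → ℕ
  lastAnchor zero    = 0
  lastAnchor (suc b) = if chosen (suc b) then suc b else lastAnchor b

  lastAnchor-≤ : ∀ b → lastAnchor b ≤ b
  lastAnchor-≤ zero = z≤n
  lastAnchor-≤ (suc b) with chosen (suc b)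
  ... | true  = ≤-refl
  ... | false = m≤n⇒m≤1+n (lastAnchor-≤ b)

  lastAnchor-anchor : ∀ b → Anchor (lastAnchor b)
  lastAnchor-anchor zero = inj₁ refl
  lastAnchor-anchor (suc b) with chosen (suc b) in e
  ... | true  = inj₂ e
  ... | false = lastAnchor-anchor b

  lastAnchor-fixed : ∀ {b} → Anchor b → lastAnchor b ≡ b
  lastAnchor-fixed {zero}  _        = refl
  lastAnchor-fixed {suc b} (inj₂ e) rewrite e = refl

  label : ℕ → ℕ
  label a = lastAnchor (blockMin X a)

  label-≤ : ∀ a → label a ≤ a
  label-≤ a = ≤-trans (lastAnchor-≤ _) (blockMin-≤ X a)

  label-fixed : ∀ {c} → Anchor c → label c ≡ c
  label-fixed     (inj₁ refl) = cong lastAnchor (n≤0⇒n≡0 (blockMin-≤ X 0))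
  label-fixed {c} (inj₂ e)    = trans
    (cong lastAnchor (blockMin-fixed X (proj₂ (chosen-isBlockMin {c} e))))
    (lastAnchor-fixed (inj₂ e))

  Y : Partition
  Y = fibres label λ n → let m , n≤m , cm = chosen-infinite n in m , n≤m , label-fixed (inj₂ cm)

  Y≼X : Y ≼ X
  Y≼X a b a~b = dec-true (label a ≟ label b) (cong lastAnchor (same⇒blockMin-≡ X a~b))

  chosen⇒isBlockMin-Y : ∀ {b} → chosen b ≡ true → IsBlockMin (same Y) b
  chosen⇒isBlockMin-Y {b} e {a} a<b = dec-false (label a ≟ label b)
    (λ la≡lb → <⇒≢ (≤-<-trans (label-≤ a) a<b) (trans la≡lb (label-fixed (inj₂ e))))

  isBlockMin-Y⇒chosen : ∀ {b} → 0 < b → IsBlockMin (same Y) b → chosen b ≡ true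
  isBlockMin-Y⇒chosen {b} b>0 min
    with lastAnchor-anchor (blockMin X b) | m≤n⇒m<n∨m≡n (label-≤ b)
  ... | anchor     | inj₁ lb<b = contradiction
    (trans (sym (dec-true (label (label b) ≟ label b) (label-fixed anchor))) (min lb<b)) λ ()
  ... | inj₁ lb≡0  | inj₂ lb≡b = contradiction (trans (sym lb≡b) lb≡0) (>⇒≢ b>0)
  ... | inj₂ chose | inj₂ lb≡b = subst (λ c → chosen c ≡ true) lb≡b chose

  minima-Y : minima (pc Y) ≗ y
  minima-Y j = Bool.⇔→≡ (mk⇔ minima⇒y y⇒minima)
    where
    minima⇒y : minima (pc Y) j ≡ true → y j ≡ true
    minima⇒y e with minima-support (pc Y) j e
    ... | b , refl = let b>0 , min = to (minima-pc Y b) e in isBlockMin-Y⇒chosen b>0 min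
    y⇒minima : y j ≡ true → minima (pc Y) j ≡ true
    y⇒minima e with minima-support (pc X) j (y⊆minima j e)
    ... | b , refl = from (minima-pc Y b) (proj₁ (chosen-isBlockMin e) , chosen⇒isBlockMin-Y e)

coarsening : ∀ X y → Infinite y → y ⊆ʳ minima (pc X) → ∃ λ Y → Y ≼ X × minima (pc Y) ≗ y
coarsening X y y-infinite y⊆minima = Y , Y≼X , minima-Y
  where open Coarsening X y y-infinite y⊆minima

minima-homogeneous : ∀ {P : Real → Set} → P Respects _≗_ → ∀ X →
                     (∀ Y → Y ≼ X → P (minima (pc Y))) →
                     ∀ y → Infinite y → y ⊆ʳ minima (pc X) → P y
minima-homogeneous P-respects X P-below y y-infinite y⊆minima =
  let Y , Y≼X , minimaY≗y = coarsening X y y-infinite y⊆minima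
  in P-respects minimaY≗y (P-below Y Y≼X)

proposition2p6 : (n : ℕ) → 1 ≤ n →
    (∀ A → Δ¹ n A → DualRamseyProperty A) →
    ∀ A → Δ¹ n A → RamseyProperty A
proposition2p6 n _ dualRamsey A (A∈Σ¹ , A∈Π¹) =
  minima (pc X) , minima-infinite X ,
  Sum.map (minima-homogeneous A-respects X) (minima-homogeneous ¬A-respects X) homogeneous
  where
  preimage-Δ¹ : Δ¹ n (A ∘ minima)
  preimage-Δ¹ = preimage-Σ¹ minima-nonExpansive n A∈Σ¹ , preimage-Π¹ minima-nonExpansive n A∈Π¹
  X = proj₁ (dualRamsey (A ∘ minima) preimage-Δ¹)
  homogeneous = proj₂ (dualRamsey (A ∘ minima) preimage-Δ¹)
  A-respects : A Respects _≗_
  A-respects = Σ¹-respects-≗ n A∈Σ¹ (λ ())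
  ¬A-respects : (¬_ ∘ A) Respects _≗_
  ¬A-respects x≗x′ ¬Ax = ¬Ax ∘ A-respects (sym ∘ x≗x′)
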